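{- Let $G$ be a simple graph, $D$ a positive integer with $D\ge\Delta(G)$, and $\pi$ a partial $D$-edge-coloring of $G$. Let $xy_1$ be a $(D,x)$-weak edge and let $F=(x,y_1,\ldots,y_k)$ be a fan that is not active. Then there is a vertex $y_{k+1}$ such that $(x,y_1,\ldots,y_{k+1})$ is a fan.
   Context: A partial $D$-edge-coloring of $G$ is a function $\pi:E(G)\to\{1,\ldots,D\}\cup\{\bot\}$ ($\bot$ meaning uncolored) such that incident edges both colored from $\{1,\ldots,D\}$ get different colors. For a vertex $v$, $\pi(v)=\{\pi(vw):w\in N(v)\}\setminus\{\bot\}$ and $\bar\pi(v)=\{1,\ldots,D\}\setminus\pi(v)$. $d^D(u)$ is the number of neighbors of $u$ of degree exactly $D$; $[P]$ is $1$ if $P$ holds and $0$ otherwise. An edge $uv$ is $(D,u)$-weak if $d^D(u)\le D-d(v)+[d(v)=D]$. A fan is a sequence $F=(x,y_1,\ldots,y_k)$ such that (F1) $y_1,\ldots,y_k$ are distinct neighbors of $x$; (F2) $xy_1$ is uncolored; (F3) for $i=2,\ldots,k$, $xy_i$ is colored and $\pi(xy_i)\in\bigcup_{j<i}\bar\pi(y_j)$; (F4) for $i=2,\ldots,k$, $d(y_i)<D$. A fan is active if (A1) $\bar\pi(y_i)\cap\bar\pi(x)\neq\emptyset$ for some $i$, or (A2) $\bar\pi(y_i)\cap\bar\pi(y_j)\neq\emptyset$ for some distinct $i,j$. -}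

module Defs where

open import Data.Nat using (ℕ; zero; suc; _+_; _∸_; _≤_; _<_)
open import Data.Bool using (Bool; true; false; T)
open import Data.Fin using (Fin; toℕ)
open import Data.Maybe using (Maybe; just; nothing)
open import Data.List using (List; []; _∷_; length; lookup; filterᵇ; allFin)
open import Data.List.Relation.Unary.All using (All)
open import Data.List.Relation.Unary.Unique.Propositional using (Unique)
open import Data.Product using (Σ; ∃; ∃-syntax; _×_; _,_)
open import Relation.Binary.PropositionalEquality using (_≡_; _≢_)
open import Relation.Nullary using (¬_; does)
open import Data.Nat using (_≟_)
open import Data.Sum using (_⊎_)
import Data.Empty

record SimpleGraph (n : ℕ) : Set where
  field
    adj    : Fin n → Fin n → Bool
    sym    : ∀ u v → adj u v ≡ adj v u
    irrefl : ∀ v → adj v v ≡ false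
open SimpleGraph public

module _ {n : ℕ} (G : SimpleGraph n) where

  Adj : Fin n → Fin n → Set
  Adj u v = T (adj G u v)

  nbrs : Fin n → List (Fin n)
  nbrs v = filterᵇ (adj G v) (allFin n)

  deg : Fin n → ℕ
  deg v = length (nbrs v)

  MaxDegAtMost : ℕ → Set
  MaxDegAtMost D = ∀ v → deg v ≤ D

  degD : ℕ → Fin n → ℕ
  degD D u = length (filterᵇ (λ w → does (deg w ≟ D)) (nbrs u))

  iverDeg : ℕ → Fin n → ℕ
  iverDeg D v with deg v ≟ D
  ... | Relation.Nullary.yes _ = 1
  ... | Relation.Nullary.no _ = 0

  -- edge uv is (D,u)-weak (subtraction is truncated; D ≥ d(v) in our use)
  Weak : ℕ → Fin n → Fin n → Set
  Weak D u v = degD D u ≤ (D ∸ deg v) + iverDeg D v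

  -- A partial D-edge-colouring: colours Fin D stand for {1,…,D}, nothing = ⊥.
  -- Only values on edges are meaningful.
  record PartialColoring (D : ℕ) : Set where
    field
      col    : Fin n → Fin n → Maybe (Fin D)
      colSym : ∀ u v → col u v ≡ col v u
      proper : ∀ u v w (c : Fin D) → Adj u v → Adj u w → v ≢ w →
               col u v ≡ just c → col u w ≡ just c → Data.Empty.⊥
  open PartialColoring public

  module _ {D : ℕ} (π : PartialColoring D) where

    Seen : Fin n → Fin D → Set
    Seen v c = ∃[ w ] (Adj v w × col π v w ≡ just c)

    Missing : Fin n → Fin D → Set
    Missing v c = ¬ Seen v c

    -- (x, y₁, …, y_k) is a fan, ys = y₁ ∷ … ∷ y_k (indices 0-based)
    IsFan : Fin n → List (Fin n) → Set
    IsFan x ys =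
      All (Adj x) ys × Unique ys ×
      (∃[ y₁ ] ∃[ rest ] (ys ≡ y₁ ∷ rest × col π x y₁ ≡ nothing)) ×
      (∀ (i : Fin (length ys)) → 1 ≤ toℕ i →
         (∃[ c ] (col π x (lookup ys i) ≡ just c ×
            ∃[ j ] (toℕ {length ys} j < toℕ i × Missing (lookup ys j) c)))
         × deg (lookup ys i) < D)

    Active : Fin n → List (Fin n) → Set
    Active x ys =
      (∃[ i ] ∃[ c ] (Missing (lookup ys i) c × Missing x c))
      ⊎ (∃[ i ] ∃[ j ] (i ≢ j × ∃[ c ] (Missing (lookup ys i) c × Missing (lookup ys j) c)))

{-# OPTIONS --safe #-}
-- Non-activity makes the colour sets missing at x, y₁, …, y_k pairwise disjoint, so the fan
-- misses at least |π̄(y₁)| + (k − 1) ≥ D − d(y₁) + k colours, none of them missing at x, hence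
-- sitting on distinct edges at x.  At most k − 1 of those edges lead back into the fan (xy₁ is
-- uncoloured).  If none of the others reaches a new vertex of degree < D, then x has at least
-- D − d(y₁) + 1 + [d(y₁) = D] neighbours of degree D, against xy₁ being (D,x)-weak.
--
-- Every count is a pigeonhole for a relation injective in its first argument, here "m is the
-- colour of the edge vw" with m : Maybe colour, so that an uncoloured edge is matched with nothing.
module Submission where

open import Defs
open import Data.Nat using (ℕ; _≤_)
open import Data.Fin using (Fin)
open import Data.List using (List; _∷_; []; _++_)
open import Data.Product using (∃-syntax)
open import Relation.Nullary using (¬_)

open import Data.Nat using (suc; _+_; _∸_; _<_; z≤n; s≤s)
open import Data.Nat.Properties
open import Data.Fin using (toℕ) renaming (zero to fzero; suc to fsuc; _≟_ to _≟ᶠ_)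
import Data.Fin.Properties as Fin
open import Data.Bool using (T; T?)
open import Data.Maybe using (just; nothing)
import Data.Maybe.Properties as Maybe
open import Data.List using (length; lookup; filter; filterᵇ; allFin; map; concatMap; _∷ʳ_)
open import Data.List.Properties
  using (length-++; length-++-sucʳ; length-map; length-tabulate; tabulate-lookup)
open import Data.List.Membership.Propositional using (_∈_; _∉_; find; lose)
open import Data.List.Membership.Propositional.Properties
  using (∈-∃++; ∈-filter⁺; ∈-filter⁻; ∈-map⁻; ∈-allFin; ∈-concatMap⁻)
open import Data.List.Relation.Unary.Any as Any using (Any; here; there)
import Data.List.Relation.Unary.Any.Properties as Any
open import Data.List.Relation.Unary.All as All using (All; []; _∷_)
import Data.List.Relation.Unary.All.Properties as All
open import Data.List.Relation.Unary.AllPairs using (AllPairs)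
import Data.List.Relation.Unary.AllPairs.Properties as AllPairs
open import Data.List.Relation.Unary.Unique.Propositional using (Unique; []; _∷_)
import Data.List.Relation.Unary.Unique.Propositional.Properties as Unique
open import Data.List.Relation.Binary.Disjoint.Propositional using (Disjoint)
open import Data.Product using (_×_; _,_; proj₁; proj₂)
open import Data.Sum using (_⊎_; inj₁; inj₂)
open import Data.Empty using (⊥; ⊥-elim)
open import Function using (_∘_; _on_)
open import Relation.Nullary using (yes; no; does; ¬?; _×-dec_)
open import Relation.Nullary.Decidable using (decidable-stable)
open import Relation.Unary using (Decidable)
open import Relation.Unary.Properties using (∁?)
open import Relation.Binary.PropositionalEquality
  using (_≡_; refl; trans; cong; subst; subst₂)
  renaming (sym to ≡-sym)

module _ {A B : Set} where

  Unique⇒length≤ : {R : A → B → Set} {as : List A} {bs : List B} →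
                   (∀ {a a′ b} → R a b → R a′ b → a ≡ a′) → Unique as →
                   (∀ {a} → a ∈ as → Any (R a) bs) → length as ≤ length bs
  Unique⇒length≤ {as = []} _ _ _ = z≤n
  Unique⇒length≤ {R} {a ∷ as} R-inj (a∉as ∷ as!) partner
    with b , b∈bs , Rab ← find (partner (here refl))
    with ps , qs , refl ← ∈-∃++ b∈bs
    = subst (suc (length as) ≤_) (≡-sym (length-++-sucʳ ps b qs))
        (s≤s (Unique⇒length≤ R-inj as! partner′))
    where
    partner′ : ∀ {a′} → a′ ∈ as → Any (R a′) (ps ++ qs)
    partner′ a′∈as with Any.++⁻ ps (partner (there a′∈as))
    ... | inj₁ p = Any.++⁺ˡ p
    ... | inj₂ (here Ra′b) = ⊥-elim (All.lookup a∉as a′∈as (R-inj Rab Ra′b))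
    ... | inj₂ (there q) = Any.++⁺ʳ ps q

  length≤length-concatMap : {f : A → List B} {xs : List A} →
                            All (λ x → 0 < length (f x)) xs → length xs ≤ length (concatMap f xs)
  length≤length-concatMap [] = z≤n
  length≤length-concatMap {f} {x ∷ xs} (nonempty ∷ nonempties) = begin
    suc (length xs)                         ≤⟨ +-mono-≤ nonempty (length≤length-concatMap nonempties) ⟩
    length (f x) + length (concatMap f xs)  ≡⟨ length-++ (f x) ⟨
    length (concatMap f (x ∷ xs))           ∎
    where open ≤-Reasoning

module _ {A : Set} where

  length-filter+length-filter-∁ : {P : A → Set} (P? : Decidable P) (xs : List A) →
                                  length (filter P? xs) + length (filter (∁? P?) xs) ≡ length xs
  length-filter+length-filter-∁ P? [] = refl
  length-filter+length-filter-∁ P? (x ∷ xs) with P? x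
  ... | yes _ = cong suc (length-filter+length-filter-∁ P? xs)
  ... | no _ = trans (+-suc _ _) (cong suc (length-filter+length-filter-∁ P? xs))

  Unique-map-just : {xs : List A} → Unique xs → Unique (map just xs)
  Unique-map-just = Unique.map⁺ Maybe.just-injective

  Unique-nothing∷map-just : {xs : List A} → Unique xs → Unique (nothing ∷ map just xs)
  Unique-nothing∷map-just xs! = All.map⁺ (All.universal (λ _ ()) _) ∷ Unique-map-just xs!

  lookup-∷ʳ⁻ : (xs : List A) (y : A) (i : Fin (length (xs ∷ʳ y))) →
               (∃[ i′ ] (toℕ i′ ≡ toℕ i × lookup (xs ∷ʳ y) i ≡ lookup xs i′))
               ⊎ (toℕ i ≡ length xs × lookup (xs ∷ʳ y) i ≡ y)
  lookup-∷ʳ⁻ [] y fzero = inj₂ (refl , refl)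
  lookup-∷ʳ⁻ (x ∷ xs) y fzero = inj₁ (fzero , refl , refl)
  lookup-∷ʳ⁻ (x ∷ xs) y (fsuc i) with lookup-∷ʳ⁻ xs y i
  ... | inj₁ (i′ , i′≡i , eq) = inj₁ (fsuc i′ , cong suc i′≡i , eq)
  ... | inj₂ (i≡ , eq) = inj₂ (cong suc i≡ , eq)

  lookup-∷ʳ⁺ : (xs : List A) (y : A) (j : Fin (length xs)) →
               ∃[ j′ ] (toℕ j′ ≡ toℕ j × lookup (xs ∷ʳ y) j′ ≡ lookup xs j)
  lookup-∷ʳ⁺ (x ∷ xs) y fzero = fzero , refl , refl
  lookup-∷ʳ⁺ (x ∷ xs) y (fsuc j) with j′ , j′≡j , eq ← lookup-∷ʳ⁺ xs y j
    = fsuc j′ , cong suc j′≡j , eq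

module _ {n : ℕ} (G : SimpleGraph n) where

  Adj-sym : ∀ {u v} → Adj G u v → Adj G v u
  Adj-sym {u} {v} = subst T (sym G u v)

  ∈-nbrs⁺ : ∀ {v w} → Adj G v w → w ∈ nbrs G v
  ∈-nbrs⁺ {v} {w} = ∈-filter⁺ (T? ∘ adj G v) (∈-allFin w)

  ∈-nbrs⁻ : ∀ {v w} → w ∈ nbrs G v → Adj G v w
  ∈-nbrs⁻ {v} = proj₂ ∘ ∈-filter⁻ (T? ∘ adj G v) {xs = allFin n}

  nbrsOfDeg : ℕ → Fin n → List (Fin n)
  nbrsOfDeg d v = filterᵇ (λ w → does (deg G w ≟ d)) (nbrs G v)

  ∈-nbrsOfDeg⁺ : ∀ {d v w} → Adj G v w → deg G w ≡ d → w ∈ nbrsOfDeg d v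
  ∈-nbrsOfDeg⁺ {d} {w = w} vw deg≡d =
    -- does (m ≟ n) computes to m ≡ᵇ n
    ∈-filter⁺ (λ u → T? (does (deg G u ≟ d))) (∈-nbrs⁺ vw) (≡⇒≡ᵇ (deg G w) d deg≡d)

  module _ {D : ℕ} (π : PartialColoring G D) where

    seen? : ∀ v → Decidable (Seen G π v)
    seen? v c = Fin.any? (λ w → T? (adj G v w) ×-dec Maybe.≡-dec _≟ᶠ_ (col π v w) (just c))

    seenColours missingColours : Fin n → List (Fin D)
    seenColours v = filter (seen? v) (allFin D)
    missingColours v = filter (∁? (seen? v)) (allFin D)

    Unique-seenColours : ∀ v → Unique (seenColours v)
    Unique-seenColours v = Unique.filter⁺ (seen? v) (Unique.allFin⁺ D)

    Unique-missingColours : ∀ v → Unique (missingColours v)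
    Unique-missingColours v = Unique.filter⁺ (∁? (seen? v)) (Unique.allFin⁺ D)

    ∈-missingColours⁻ : ∀ {v c} → c ∈ missingColours v → Missing G π v c
    ∈-missingColours⁻ {v} = proj₂ ∘ ∈-filter⁻ (∁? (seen? v)) {xs = allFin D}

    length-seen+missing : ∀ v → length (seenColours v) + length (missingColours v) ≡ D
    length-seen+missing v =
      trans (length-filter+length-filter-∁ (seen? v) (allFin D)) (length-tabulate (λ c → c))

    edgeColour-functional : ∀ {v w m m′} → col π v w ≡ m → col π v w ≡ m′ → m ≡ m′
    edgeColour-functional colour colour′ = trans (≡-sym colour) colour′

    seenColour-edge : ∀ {v m} → m ∈ map just (seenColours v) → Any (λ w → col π v w ≡ m) (nbrs G v)
    seenColour-edge {v} m∈ with c , c∈ , refl ← ∈-map⁻ just m∈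
      with w , vw , colour ← proj₂ (∈-filter⁻ (seen? v) {xs = allFin D} c∈)
      = lose (∈-nbrs⁺ vw) colour

    length-seenColours≤deg : ∀ v → length (seenColours v) ≤ deg G v
    length-seenColours≤deg v = subst (_≤ deg G v) (length-map just (seenColours v))
      (Unique⇒length≤ edgeColour-functional (Unique-map-just (Unique-seenColours v)) seenColour-edge)

    length-seenColours<deg : ∀ {v u} → Adj G v u → col π v u ≡ nothing →
                             length (seenColours v) < deg G v
    length-seenColours<deg {v} {u} vu uncoloured =
      subst (λ k → suc k ≤ deg G v) (length-map just (seenColours v))
      (Unique⇒length≤ edgeColour-functional (Unique-nothing∷map-just (Unique-seenColours v)) edge)
      where
      edge : ∀ {m} → m ∈ nothing ∷ map just (seenColours v) → Any (λ w → col π v w ≡ m) (nbrs G v)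
      edge (here refl) = lose (∈-nbrs⁺ vu) uncoloured
      edge (there m∈) = seenColour-edge m∈

    missingColours-nonempty : ∀ {v} → deg G v < D → 0 < length (missingColours v)
    missingColours-nonempty {v} deg<D = +-cancelˡ-≤ (length (seenColours v)) 1 _ (begin
      length (seenColours v) + 1                          ≡⟨ +-comm _ 1 ⟩
      suc (length (seenColours v))                        ≤⟨ s≤s (length-seenColours≤deg v) ⟩
      suc (deg G v)                                       ≤⟨ deg<D ⟩
      D                                                   ≡⟨ length-seen+missing v ⟨
      length (seenColours v) + length (missingColours v)  ∎)
      where open ≤-Reasoning

    D<missing+deg : ∀ {v u} → Adj G v u → col π v u ≡ nothing →
                    D < length (missingColours v) + deg G v
    D<missing+deg {v} vu uncoloured = begin-strict
      D                                                   ≡⟨ length-seen+missing v ⟨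
      length (seenColours v) + length (missingColours v)  ≡⟨ +-comm (length (seenColours v)) _ ⟩
      length (missingColours v) + length (seenColours v)
        <⟨ +-monoʳ-< _ (length-seenColours<deg vu uncoloured) ⟩
      length (missingColours v) + deg G v                 ∎
      where open ≤-Reasoning

    fanColours : List (Fin n) → List (Fin D)
    fanColours = concatMap missingColours

    ∈-fanColours⁻ : ∀ {ys c} → c ∈ fanColours ys → Any (λ w → Missing G π w c) ys
    ∈-fanColours⁻ {ys} c∈ = Any.map ∈-missingColours⁻ (∈-concatMap⁻ missingColours {xs = ys} c∈)

    length-fanColours : ∀ {y rest} → All (λ w → deg G w < D) rest →
                        length (missingColours y) + length rest ≤ length (fanColours (y ∷ rest))
    length-fanColours {y} {rest} rest-deg<D = begin
      length (missingColours y) + length rest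
        ≤⟨ +-monoʳ-≤ _ (length≤length-concatMap (All.map missingColours-nonempty rest-deg<D)) ⟩
      length (missingColours y) + length (fanColours rest)  ≡⟨ length-++ (missingColours y) ⟨
      length (fanColours (y ∷ rest))                        ∎
      where open ≤-Reasoning

    module _ {x : Fin n} {ys : List (Fin n)} (inactive : ¬ Active G π x ys) where

      fanColour-seen : ∀ {c} → c ∈ fanColours ys → Seen G π x c
      fanColour-seen {c} c∈ = decidable-stable (seen? x c) λ unseen →
        inactive (inj₁ (Any.index missing , c , Any.lookup-index missing , unseen))
        where
        missing : Any (λ w → Missing G π w c) ys
        missing = ∈-fanColours⁻ c∈

      Unique-fanColours : Unique (fanColours ys)
      Unique-fanColours =
        Unique.concat⁺ (All.map⁺ (All.tabulate (λ {v} _ → Unique-missingColours v)))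
                       (AllPairs.map⁺ missingColours-disjoint)
        where
        missingColours-disjoint : AllPairs (Disjoint on missingColours) ys
        missingColours-disjoint =
          subst (AllPairs _) (tabulate-lookup ys) (AllPairs.tabulate⁺ λ i≢j (c∈i , c∈j) →
            inactive (inj₂ (_ , _ , i≢j , _ , ∈-missingColours⁻ c∈i , ∈-missingColours⁻ c∈j)))

    FanStep : Fin n → (ys : List (Fin n)) → Fin (length ys) → Set
    FanStep x ys i =
      (∃[ c ] (col π x (lookup ys i) ≡ just c ×
        ∃[ j ] (toℕ {length ys} j < toℕ i × Missing G π (lookup ys j) c)))
      × deg G (lookup ys i) < D

    IsFan-∷ʳ : ∀ {x ys y c} → IsFan G π x ys → Adj G x y → y ∉ ys → col π x y ≡ just c →
               Any (λ w → Missing G π w c) ys → deg G y < D → IsFan G π x (ys ∷ʳ y)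
    IsFan-∷ʳ {x} {ys} {y} {c} (adjacent , distinct , (y₁ , rest , refl , uncoloured) , steps)
             xy y∉ys colour missing deg<D =
      All.++⁺ adjacent (xy ∷ []) , Unique.++⁺ distinct ([] ∷ []) y∉ys′ ,
      (y₁ , rest ∷ʳ y , refl , uncoloured) , step
      where
      y∉ys′ : ∀ {v} → ¬ (v ∈ ys × v ∈ y ∷ [])
      y∉ys′ (y∈ys , here refl) = y∉ys y∈ys

      old-step : ∀ i (i′ : Fin (length ys)) → toℕ i′ ≡ toℕ i → lookup (ys ∷ʳ y) i ≡ lookup ys i′ →
                 FanStep x ys i′ → FanStep x (ys ∷ʳ y) i
      old-step i i′ i′≡i eq ((c′ , colour′ , j , j<i′ , missing′) , deg′<D)
        with j′ , j′≡j , eq′ ← lookup-∷ʳ⁺ ys y j =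
        (c′ , subst (λ w → col π x w ≡ just c′) (≡-sym eq) colour′ ,
         j′ , subst₂ _<_ (≡-sym j′≡j) i′≡i j<i′ ,
         subst (λ w → Missing G π w c′) (≡-sym eq′) missing′) ,
        subst (λ w → deg G w < D) (≡-sym eq) deg′<D

      new-step : ∀ i → toℕ i ≡ length ys → lookup (ys ∷ʳ y) i ≡ y → FanStep x (ys ∷ʳ y) i
      new-step i i≡ eq with j′ , j′≡j , eq′ ← lookup-∷ʳ⁺ ys y (Any.index missing) =
        (c , subst (λ w → col π x w ≡ just c) (≡-sym eq) colour ,
         j′ , subst₂ _<_ (≡-sym j′≡j) (≡-sym i≡) (Fin.toℕ<n (Any.index missing)) ,
         subst (λ w → Missing G π w c) (≡-sym eq′) (Any.lookup-index missing)) ,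
        subst (λ w → deg G w < D) (≡-sym eq) deg<D

      step : ∀ i → 1 ≤ toℕ i → FanStep x (ys ∷ʳ y) i
      step i 1≤i with lookup-∷ʳ⁻ ys y i
      ... | inj₁ (i′ , i′≡i , eq) = old-step i i′ i′≡i eq (steps i′ (subst (1 ≤_) (≡-sym i′≡i) 1≤i))
      ... | inj₂ (i≡ , eq) = new-step i i≡ eq

    IsFan⇒first-uncoloured : ∀ {x y₁ rest} → IsFan G π x (y₁ ∷ rest) →
                             Adj G x y₁ × col π x y₁ ≡ nothing
    IsFan⇒first-uncoloured (adjacent , _ , (_ , _ , refl , uncoloured) , _) =
      All.head adjacent , uncoloured

    IsFan⇒rest-deg<D : ∀ {x y₁ rest} → IsFan G π x (y₁ ∷ rest) → All (λ w → deg G w < D) rest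
    IsFan⇒rest-deg<D {rest = rest} (_ , _ , _ , steps) =
      subst (All _) (tabulate-lookup rest) (All.tabulate⁺ λ i → proj₂ (steps (fsuc i) (s≤s z≤n)))

    FanCandidate : Fin n → List (Fin n) → Fin n → Set
    FanCandidate x ys w = w ∉ ys × deg G w < D × Any (λ c → col π x w ≡ just c) (fanColours ys)

    fanCandidate? : ∀ x ys → Decidable (FanCandidate x ys)
    fanCandidate? x ys w =
      ¬? (Any.any? (w ≟ᶠ_) ys) ×-dec deg G w <? D ×-dec
      Any.any? (λ c → Maybe.≡-dec _≟ᶠ_ (col π x w) (just c)) (fanColours ys)

    module _ {x y₁ : Fin n} {rest : List (Fin n)} (Δ≤D : MaxDegAtMost G D)
             (inactive : ¬ Active G π x (y₁ ∷ rest)) (uncoloured : col π x y₁ ≡ nothing)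
             (blocked : ¬ Any (FanCandidate x (y₁ ∷ rest)) (nbrs G x)) where

      blocked-fanColour-edge : ∀ {m} → m ∈ map just (fanColours (y₁ ∷ rest)) →
                               Any (λ w → col π x w ≡ m) (rest ++ nbrsOfDeg D x)
      blocked-fanColour-edge m∈ with c , c∈U , refl ← ∈-map⁻ just m∈
        with w , xw , colour ← fanColour-seen inactive c∈U
        with Any.any? (w ≟ᶠ_) (y₁ ∷ rest)
      ... | yes (here refl) with () ← trans (≡-sym uncoloured) colour
      ... | yes (there w∈rest) = Any.++⁺ˡ (lose w∈rest colour)
      ... | no w∉ys = Any.++⁺ʳ rest (lose (∈-nbrsOfDeg⁺ xw deg≡D) colour)
        where
        deg≡D : deg G w ≡ D
        deg≡D = ≤-antisym (Δ≤D w) (≮⇒≥ λ deg<D →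
          blocked (lose (∈-nbrs⁺ xw) (w∉ys , deg<D , lose c∈U colour)))

      blocked-length-fanColours≤ :
        Adj G x y₁ → length (fanColours (y₁ ∷ rest)) + iverDeg G D y₁ ≤ length rest + degD G D x
      blocked-length-fanColours≤ xy₁ with deg G y₁ ≟ D
      ... | yes deg≡D =
        subst₂ _≤_ (trans (cong suc (length-map just (fanColours (y₁ ∷ rest)))) (+-comm 1 _))
                   (length-++ rest)
          (Unique⇒length≤ edgeColour-functional
                          (Unique-nothing∷map-just (Unique-fanColours inactive)) edge)
        where
        edge : ∀ {m} → m ∈ nothing ∷ map just (fanColours (y₁ ∷ rest)) →
               Any (λ w → col π x w ≡ m) (rest ++ nbrsOfDeg D x)
        edge (here refl) = Any.++⁺ʳ rest (lose (∈-nbrsOfDeg⁺ xy₁ deg≡D) uncoloured)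
        edge (there m∈) = blocked-fanColour-edge m∈
      ... | no _ =
        subst₂ _≤_ (trans (length-map just (fanColours (y₁ ∷ rest))) (≡-sym (+-identityʳ _)))
                   (length-++ rest)
          (Unique⇒length≤ edgeColour-functional (Unique-map-just (Unique-fanColours inactive))
                          blocked-fanColour-edge)

fan-counts-inconsistent : ∀ {D d m r u i e : ℕ} → d ≤ D → D < m + d → m + r ≤ u → u + i ≤ r + e →
                          e ≤ (D ∸ d) + i → ⊥
fan-counts-inconsistent {D} {d} {m} {r} {u} {i} {e} d≤D D<m+d m+r≤u u+i≤r+e e≤D∸d+i =
  <-irrefl refl (begin-strict
    D             <⟨ D<m+d ⟩
    m + d         ≤⟨ +-monoˡ-≤ d m≤D∸d ⟩
    (D ∸ d) + d   ≡⟨ m∸n+n≡m d≤D ⟩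
    D             ∎)
  where
  open ≤-Reasoning
  m≤D∸d : m ≤ D ∸ d
  m≤D∸d = +-cancelʳ-≤ r m (D ∸ d) (+-cancelʳ-≤ i (m + r) (D ∸ d + r) (begin
    m + r + i         ≤⟨ +-monoˡ-≤ i m+r≤u ⟩
    u + i             ≤⟨ u+i≤r+e ⟩
    r + e             ≤⟨ +-monoʳ-≤ r e≤D∸d+i ⟩
    r + (D ∸ d + i)   ≡⟨ +-assoc r (D ∸ d) i ⟨
    r + (D ∸ d) + i   ≡⟨ cong (_+ i) (+-comm r (D ∸ d)) ⟩
    D ∸ d + r + i     ∎))

lemma7 : ∀ {n : ℕ} (G : SimpleGraph n) (D : ℕ) → 1 ≤ D → MaxDegAtMost G D →
         (π : PartialColoring G D) (x y₁ : Fin n) (rest : List (Fin n)) →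
         Weak G D x y₁ →
         IsFan G π x (y₁ ∷ rest) →
         ¬ Active G π x (y₁ ∷ rest) →
         ∃[ y ] IsFan G π x ((y₁ ∷ rest) ++ (y ∷ []))
lemma7 G D _ Δ≤D π x y₁ rest weak fan inactive
  with Any.any? (fanCandidate? G π x (y₁ ∷ rest)) (nbrs G x)
... | yes candidate
  with w , w∈nbrs , w∉ys , deg<D , coloured ← find candidate
  with c , c∈U , colour ← find coloured
  = w , IsFan-∷ʳ G π fan (∈-nbrs⁻ G w∈nbrs) w∉ys colour (∈-fanColours⁻ G π c∈U) deg<D
... | no blocked = ⊥-elim (fan-counts-inconsistent (Δ≤D y₁)
  (D<missing+deg G π (Adj-sym G xy₁) (trans (colSym π y₁ x) uncoloured))
  (length-fanColours G π (IsFan⇒rest-deg<D G π fan))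
  (blocked-length-fanColours≤ G π Δ≤D inactive uncoloured blocked xy₁)
  weak)
  where
  xy₁ : Adj G x y₁
  xy₁ = proj₁ (IsFan⇒first-uncoloured G π fan)
  uncoloured : col π x y₁ ≡ nothing
  uncoloured = proj₂ (IsFan⇒first-uncoloured G π fan)
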